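{- Let $E$ be a finite set and $\tau:2^{E}\to2^{E}$ an operator such that $(E,\tau)$ is a convex space, i.e. (C1) $X\subseteq\tau(X)$ for all $X\subseteq E$, and (Convexity) for all $X\subseteq Y\subseteq Z\subseteq E$ with $\tau(X)=\tau(Z)$ we have $\tau(Y)=\tau(X)=\tau(Z)$. For $X\subseteq E$ let $EX(X)=\{x\in X:\tau(X)\neq\tau(X\setminus\{x\})\}$. Then $(E,\tau)$ is uniquely generated if and only if $\tau(X)=\tau(EX(X))$ for every $X\subseteq E$.
   Context: Standing convention: generators and bases of a set $X$ are taken to be subsets of $X$. That is, a generator of $X$ is a set $B\subseteq X$ with $\tau(B)=\tau(X)$, a basis of $X$ is an inclusion-minimal generator of $X$, and $(E,\tau)$ is uniquely generated if every $X\subseteq E$ has exactly one basis. -}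

module Defs where

open import Data.Nat using (ℕ)
open import Data.Bool using (Bool; true; false; _∧_; not)
open import Data.Bool.Properties using () renaming (_≟_ to _≟ᵇ_)
open import Data.Fin using (Fin)
open import Data.Fin.Subset using (Subset; _⊆_; _-_; _∈_)
open import Data.Vec using (Vec; lookup; tabulate)
open import Data.Vec.Properties using (≡-dec)
open import Data.Product using (_×_; ∃; Σ-syntax)
open import Relation.Nullary using (¬_; Dec; yes; no)
open import Relation.Nullary.Decidable using (⌊_⌋)
open import Relation.Binary.PropositionalEquality using (_≡_)

-- The ground set E is modelled as Fin n; subsets of E as Subset n
-- (characteristic vectors), so equality of subsets is _≡_.

_≟ˢ_ : ∀ {n} (X Y : Subset n) → Dec (X ≡ Y)
_≟ˢ_ = ≡-dec _≟ᵇ_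

Operator : ℕ → Set
Operator n = Subset n → Subset n

C1 : ∀ {n} → Operator n → Set
C1 {n} τ = ∀ (X : Subset n) → X ⊆ τ X

Convexity : ∀ {n} → Operator n → Set
Convexity {n} τ = ∀ (X Y Z : Subset n) → X ⊆ Y → Y ⊆ Z → τ X ≡ τ Z →
  (τ Y ≡ τ X) × (τ X ≡ τ Z)

ConvexSpace : ∀ {n} → Operator n → Set
ConvexSpace τ = C1 τ × Convexity τ

IsGenerator : ∀ {n} → Operator n → Subset n → Subset n → Set
IsGenerator τ X B = B ⊆ X × τ B ≡ τ X

IsBasis : ∀ {n} → Operator n → Subset n → Subset n → Set
IsBasis τ X B = IsGenerator τ X B ×
  (∀ B′ → IsGenerator τ X B′ → B′ ⊆ B → B′ ≡ B)

HasUniqueBasis : ∀ {n} → Operator n → Subset n → Set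
HasUniqueBasis τ X = ∃ λ B → IsBasis τ X B × (∀ B′ → IsBasis τ X B′ → B′ ≡ B)

UniquelyGenerated : ∀ {n} → Operator n → Set
UniquelyGenerated {n} τ = ∀ (X : Subset n) → HasUniqueBasis τ X

EX : ∀ {n} → Operator n → Subset n → Subset n
EX τ X = tabulate λ x → lookup X x ∧ not ⌊ τ X ≟ˢ τ (X - x) ⌋

-- EX(X) lies inside every generator of X: if x ∉ B for a generator B, then
-- B ⊆ X ∖ {x} ⊆ X and convexity forces τ(X ∖ {x}) = τ(X). Hence if EX(X)
-- generates X it is the least generator and so the only basis. Conversely,
-- if X has a unique basis B then every b ∈ B lies in EX(X): otherwise
-- X ∖ {b} generates X and, by finiteness, contains a basis, which must be B.
-- So B = EX(X).
module Submission where

open import Defs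
open import Data.Nat using (ℕ)
open import Data.Bool using (Bool; true; _∧_; not)
open import Data.Fin using (Fin; zero; suc)
open import Data.Fin.Properties using (any?)
open import Data.Fin.Subset using (Subset; _⊆_; _⊂_; _-_; _∈_; _∉_)
open import Data.Fin.Subset.Properties
  using (_∈?_; ⊆-refl; ⊆-trans; ⊆-antisym; p─q⊆p; x∈p∧x≢y⇒x∈p-y; x∈p⇒p-x⊂p)
open import Data.Fin.Subset.Induction using (Acc; acc; ⊂-wellFounded)
open import Data.Vec using (_∷_; lookup; tabulate; there)
open import Data.Vec.Properties using ([]=⇒lookup; lookup⇒[]=; lookup∘tabulate)
open import Data.Product using (_×_; _,_; proj₁; proj₂; ∃)
open import Function.Bundles using (_⇔_; mk⇔; Equivalence)
open import Relation.Nullary using (yes; no; contradiction)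
open import Relation.Nullary.Decidable using (⌊_⌋; ¬?; _×-dec_; decidable-stable)
open import Relation.Binary.PropositionalEquality using (_≡_; _≢_; refl; sym; trans; cong; subst)

private
  variable
    n : ℕ
    p q : Subset n
    x : Fin n

x∉p-x : ∀ (p : Subset n) x → x ∉ p - x
x∉p-x (_ ∷ p) zero    ()
x∉p-x (_ ∷ p) (suc x) (there x∈p-x) = x∉p-x p x x∈p-x

p⊆q∧x∉p⇒p⊆q-x : p ⊆ q → x ∉ p → p ⊆ q - x
p⊆q∧x∉p⇒p⊆q-x p⊆q x∉p y∈p = x∈p∧x≢y⇒x∈p-y (p⊆q y∈p) λ { refl → x∉p y∈p }

p⊆q∧p≢q⇒p⊂q : p ⊆ q → p ≢ q → p ⊂ q
p⊆q∧p≢q⇒p⊂q {p = p} {q} p⊆q p≢q with any? (λ x → (x ∈? q) ×-dec ¬? (x ∈? p))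
... | yes (x , x∈q , x∉p) = p⊆q , x , x∈q , x∉p
... | no  ∄x = contradiction (⊆-antisym p⊆q q⊆p) p≢q
  where
  q⊆p : q ⊆ p
  q⊆p {x} x∈q = decidable-stable (x ∈? p) λ x∉p → ∄x (x , x∈q , x∉p)

∈-tabulate⇔ : ∀ (f : Fin n → Bool) → x ∈ tabulate f ⇔ f x ≡ true
∈-tabulate⇔ {x = x} f = mk⇔
  (λ x∈ → trans (sym (lookup∘tabulate f x)) ([]=⇒lookup x∈))
  (λ fx → lookup⇒[]= x _ (trans (lookup∘tabulate f x) fx))

module _ {τ : Operator n} where

  ∈EX⇔ : ∀ {X} → x ∈ EX τ X ⇔ (x ∈ X × τ X ≢ τ (X - x))
  ∈EX⇔ {x = x} {X} = mk⇔ to from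
    where
    f : Fin n → Bool
    f y = lookup X y ∧ not ⌊ τ X ≟ˢ τ (X - y) ⌋

    to : x ∈ EX τ X → x ∈ X × τ X ≢ τ (X - x)
    to x∈ with lookup X x in x∈X | τ X ≟ˢ τ (X - x) | Equivalence.to (∈-tabulate⇔ f) x∈
    ... | true | no τX≢τ[X-x] | refl = lookup⇒[]= x X x∈X , τX≢τ[X-x]

    from : x ∈ X × τ X ≢ τ (X - x) → x ∈ EX τ X
    from (x∈X , τX≢τ[X-x]) = Equivalence.from (∈-tabulate⇔ f) fx≡true
      where
      fx≡true : f x ≡ true
      fx≡true rewrite []=⇒lookup x∈X with τ X ≟ˢ τ (X - x)
      ... | yes τX≡τ[X-x] = contradiction τX≡τ[X-x] τX≢τ[X-x]
      ... | no  _         = refl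

  EX⊆ : ∀ X → EX τ X ⊆ X
  EX⊆ X x∈EX = proj₁ (Equivalence.to ∈EX⇔ x∈EX)

  least-generator⇒unique-basis : ∀ {X B} → IsGenerator τ X B →
    (∀ B′ → IsGenerator τ X B′ → B ⊆ B′) → HasUniqueBasis τ X
  least-generator⇒unique-basis {X} {B} gen least = B , (gen , minimal) , unique
    where
    minimal : ∀ B′ → IsGenerator τ X B′ → B′ ⊆ B → B′ ≡ B
    minimal B′ gen′ B′⊆B = ⊆-antisym B′⊆B (least B′ gen′)

    unique : ∀ B′ → IsBasis τ X B′ → B′ ≡ B
    unique B′ (gen′ , minimal′) = sym (minimal′ B gen (least B′ gen′))

  module _ (convex : Convexity τ) where

    generator-∌⇒τ[X-x]≡τX : ∀ {X B} → IsGenerator τ X B → x ∉ B → τ (X - x) ≡ τ X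
    generator-∌⇒τ[X-x]≡τX {x = x} {X} {B} (B⊆X , τB≡τX) x∉B =
      trans (proj₁ (convex B (X - x) X (p⊆q∧x∉p⇒p⊆q-x B⊆X x∉B) (p─q⊆p X _) τB≡τX)) τB≡τX

    EX⊆generator : ∀ {X B} → IsGenerator τ X B → EX τ X ⊆ B
    EX⊆generator {B = B} gen {x} x∈EX = decidable-stable (x ∈? B) λ x∉B →
      proj₂ (Equivalence.to ∈EX⇔ x∈EX) (sym (generator-∌⇒τ[X-x]≡τX gen x∉B))

    irredundant-generator⇒basis : ∀ {X G} → IsGenerator τ X G →
      (∀ {g} → g ∈ G → τ (G - g) ≢ τ X) → IsBasis τ X G
    irredundant-generator⇒basis {X} {G} gen@(_ , τG≡τX) irredundant = gen , minimal
      where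
      minimal : ∀ B′ → IsGenerator τ X B′ → B′ ⊆ G → B′ ≡ G
      minimal B′ (_ , τB′≡τX) B′⊆G = decidable-stable (B′ ≟ˢ G) λ B′≢G →
        let _ , g , g∈G , g∉B′ = p⊆q∧p≢q⇒p⊂q B′⊆G B′≢G
        in irredundant g∈G (trans (generator-∌⇒τ[X-x]≡τX B′-generates-G g∉B′) τG≡τX)
        where
        B′-generates-G : IsGenerator τ G B′
        B′-generates-G = B′⊆G , trans τB′≡τX (sym τG≡τX)

    generator⇒∃basis⊆ : ∀ {X G} → IsGenerator τ X G →
      ∃ λ B → IsBasis τ X B × B ⊆ G
    generator⇒∃basis⊆ {X} {G} = go G (⊂-wellFounded G)
      where
      go : ∀ G → Acc _⊂_ G → IsGenerator τ X G → ∃ λ B → IsBasis τ X B × B ⊆ G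
      go G (acc smaller) gen@(G⊆X , _)
        with any? (λ g → (g ∈? G) ×-dec (τ (G - g) ≟ˢ τ X))
      ... | yes (g , g∈G , τ[G-g]≡τX) =
        let B , basis , B⊆G-g = go (G - g) (smaller (x∈p⇒p-x⊂p g∈G))
                                   (⊆-trans (p─q⊆p G _) G⊆X , τ[G-g]≡τX)
        in B , basis , ⊆-trans B⊆G-g (p─q⊆p G _)
      ... | no ∄g = G , irredundant-generator⇒basis gen (λ g∈G eq → ∄g (_ , g∈G , eq)) , ⊆-refl

    unique-basis⊆EX : ∀ {X B} → IsBasis τ X B → (∀ B′ → IsBasis τ X B′ → B′ ≡ B) →
      B ⊆ EX τ X
    unique-basis⊆EX {X} ((B⊆X , _) , _) unique {b} b∈B =
      Equivalence.from ∈EX⇔ (B⊆X b∈B , b-essential)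
      where
      b-essential : τ X ≢ τ (X - b)
      b-essential τX≡τ[X-b] =
        let B′ , basis′ , B′⊆X-b = generator⇒∃basis⊆ (p─q⊆p X _ , sym τX≡τ[X-b])
        in x∉p-x X b (B′⊆X-b (subst (b ∈_) (sym (unique B′ basis′)) b∈B))

mainTheorem3 : ∀ (n : ℕ) (τ : Operator n) → ConvexSpace τ →
    (UniquelyGenerated τ → ∀ (X : Subset n) → τ X ≡ τ (EX τ X)) ×
    ((∀ (X : Subset n) → τ X ≡ τ (EX τ X)) → UniquelyGenerated τ)
mainTheorem3 n τ (_ , convex) = uniquelyGenerated⇒τ≡τEX , τ≡τEX⇒uniquelyGenerated
  where
  uniquelyGenerated⇒τ≡τEX : UniquelyGenerated τ → ∀ X → τ X ≡ τ (EX τ X)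
  uniquelyGenerated⇒τ≡τEX ug X =
    let B , basis@(gen@(_ , τB≡τX) , _) , unique = ug X
        B≡EX = ⊆-antisym (unique-basis⊆EX convex basis unique) (EX⊆generator convex gen)
    in trans (sym τB≡τX) (cong τ B≡EX)

  τ≡τEX⇒uniquelyGenerated : (∀ X → τ X ≡ τ (EX τ X)) → UniquelyGenerated τ
  τ≡τEX⇒uniquelyGenerated τ≡τEX X =
    least-generator⇒unique-basis (EX⊆ {τ = τ} X , sym (τ≡τEX X)) λ _ → EX⊆generator convex
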